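{- Let $n$ be a positive integer and let $p(x,y)$ be a bivariate polynomial of the form $$p(x,y)=\sum_{i=0}^n y^i\sum_{j=0}^{\lfloor (n-i)/2\rfloor}\mu_{n,i,j}\,x^j(1+x)^{n-i-2j}$$ with real coefficients $\mu_{n,i,j}\geqslant 0$ for all $0\leqslant i\leqslant n$ and $0\leqslant j\leqslant\lfloor (n-i)/2\rfloor$. Suppose that $\deg p(x,1)=n-1$ and that $p(x,1)$ is bi-$\gamma$-positive (with respect to degree $n-1$), i.e. there are nonnegative reals $\xi_k,\eta_k$ with $$p(x,1)=\sum_{k=0}^{\lfloor (n-1)/2\rfloor}\xi_k x^k(1+x)^{n-1-2k}+x\sum_{k=0}^{\lfloor (n-2)/2\rfloor}\eta_k x^k(1+x)^{n-2-2k}.$$ Let $y\in[0,1]$ be a fixed real number. Then $p(x,y)$, viewed as a polynomial in $x$, is alternatingly increasing: writing $p(x,y)=\sum_{\ell} p_\ell x^\ell$, one has $$p_0\leqslant p_{n-1}\leqslant p_1\leqslant p_{n-2}\leqslant p_2\leqslant\cdots\leqslant p_{\lfloor n/2\rfloor}.$$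
   Context: A polynomial $f(x)=\sum_{i=0}^d f_ix^i$ of degree $d$ is alternatingly increasing if $f_0\leqslant f_d\leqslant f_1\leqslant f_{d-1}\leqslant\cdots\leqslant f_{\lfloor (d+1)/2\rfloor}$. A polynomial $f$ of degree $d$ is bi-$\gamma$-positive if in its (unique) symmetric decomposition $f(x)=a(x)+xb(x)$, where $a(x)=\frac{f(x)-x^{d+1}f(1/x)}{1-x}$ and $b(x)=\frac{x^df(1/x)-f(x)}{1-x}$, both $a$ and $b$ are $\gamma$-positive, equivalently $f(x)=\sum_k \xi_k x^k(1+x)^{d-2k}+x\sum_k\eta_k x^k(1+x)^{d-1-2k}$ with all $\xi_k,\eta_k\geqslant 0$. -}

module Defs where

open import Level using (Level; _⊔_) renaming (suc to lsuc)
open import Data.Nat using (ℕ; zero; suc; _∸_; _<_; ⌊_/2⌋) renaming (_+_ to _+ℕ_; _*_ to _*ℕ_)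
open import Data.List using (List; []; _∷_; map)
open import Data.Product using (∃; _×_)
open import Relation.Nullary using (¬_)
open import Relation.Binary.Core using (Rel)
open import Relation.Binary.Structures using (IsTotalOrder)
open import Algebra.Bundles using (CommutativeRing)

-- Ordered fields (the real numbers are an instance).

record OrderedField (c ℓ₁ ℓ₂ : Level) : Set (lsuc (c ⊔ ℓ₁ ⊔ ℓ₂)) where
  field
    commutativeRing : CommutativeRing c ℓ₁
  open CommutativeRing commutativeRing public
  field
    _≤_          : Rel Carrier ℓ₂
    isTotalOrder : IsTotalOrder _≈_ _≤_
    +-mono-≤     : ∀ {x y} z → x ≤ y → (x + z) ≤ (y + z)
    *-nonneg     : ∀ {x y} → 0# ≤ x → 0# ≤ y → 0# ≤ (x * y)
    0≉1          : ¬ (0# ≈ 1#)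
    inverse      : ∀ x → ¬ (x ≈ 0#) → ∃ λ y → (x * y) ≈ 1#

-- Univariate polynomials over a commutative ring, as coefficient lists
-- (constant term first).

module Poly {c ℓ} (R : CommutativeRing c ℓ) where
  open CommutativeRing R

  Pol : Set c
  Pol = List Carrier

  infixl 6 _⊕_
  infixl 7 _⊗_

  _⊕_ : Pol → Pol → Pol
  [] ⊕ q = q
  (a ∷ p) ⊕ [] = a ∷ p
  (a ∷ p) ⊕ (b ∷ q) = (a + b) ∷ (p ⊕ q)

  scale : Carrier → Pol → Pol
  scale a p = map (a *_) p

  _⊗_ : Pol → Pol → Pol
  [] ⊗ q = []
  (a ∷ p) ⊗ q = scale a q ⊕ (0# ∷ (p ⊗ q))

  one : Pol
  one = 1# ∷ []

  X : Pol
  X = 0# ∷ 1# ∷ []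

  1+X : Pol
  1+X = 1# ∷ 1# ∷ []

  _^ₚ_ : Pol → ℕ → Pol
  p ^ₚ zero = one
  p ^ₚ suc k = p ⊗ (p ^ₚ k)

  coeff : Pol → ℕ → Carrier
  coeff [] m = 0#
  coeff (a ∷ p) zero = a
  coeff (a ∷ p) (suc m) = coeff p m

  Σ< : ℕ → (ℕ → Pol) → Pol
  Σ< zero f = []
  Σ< (suc m) f = Σ< m f ⊕ f m

  _^_ : Carrier → ℕ → Carrier
  a ^ zero = 1#
  a ^ suc k = a * (a ^ k)

  pxy : (n : ℕ) → (μ : ℕ → ℕ → Carrier) → (y : Carrier) → Pol
  pxy n μ y =
    Σ< (suc n) λ i → scale (y ^ i)
      (Σ< (suc ⌊ n ∸ i /2⌋) λ j →
        scale (μ i j) ((X ^ₚ j) ⊗ (1+X ^ₚ (n ∸ i ∸ 2 *ℕ j))))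

  -- Σ_{k=0}^{⌊(n-1)/2⌋} ξ_k x^k(1+x)^{n-1-2k} + x Σ_{k=0}^{⌊(n-2)/2⌋} η_k x^k(1+x)^{n-2-2k}
  -- (for n ≥ 1 the number of terms are ⌊(n-1)/2⌋+1 and ⌊n/2⌋ respectively;
  --  in particular the second sum is empty when n = 1)
  biγ : (n : ℕ) → (ξ η : ℕ → Carrier) → Pol
  biγ n ξ η =
    (Σ< (suc ⌊ n ∸ 1 /2⌋) λ k → scale (ξ k) ((X ^ₚ k) ⊗ (1+X ^ₚ (n ∸ 1 ∸ 2 *ℕ k))))
    ⊕ (X ⊗ (Σ< ⌊ n /2⌋ λ k → scale (η k) ((X ^ₚ k) ⊗ (1+X ^ₚ (n ∸ 2 ∸ 2 *ℕ k)))))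

-- Alternatingly increasing (with respect to degree d), for a coefficient
-- sequence f : f_0 ≤ f_d ≤ f_1 ≤ f_{d-1} ≤ ... ≤ f_{⌊(d+1)/2⌋}.

AlternatinglyIncreasing : ∀ {c ℓ₁ ℓ₂} (F : OrderedField c ℓ₁ ℓ₂) →
  ℕ → (ℕ → OrderedField.Carrier F) → Set ℓ₂
AlternatinglyIncreasing F d f =
  (∀ k → 2 *ℕ k < d → f k ≤ f (d ∸ k)) × (∀ k → suc (2 *ℕ k) < d → f (d ∸ k) ≤ f (suc k))
  where
    open OrderedField F using (_≤_)

-- p(x, y) = Σᵢ yⁱ pᵢ(x) with pᵢ γ-positive of degree n − i, so the coefficients of pᵢ are
-- nonnegative, symmetric about (n − i)/2 and unimodal: pᵢ,a ≤ pᵢ,b whenever b lies between a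
-- and its mirror image n − i − a.  The pair (n − 1 − k, k + 1) is symmetric about n/2, at or to the
-- right of every centre, so p_{n−1−k} ≤ p_{k+1} holds termwise for any y ≥ 0.  For the pair
-- (k, n − 1 − k), symmetric about (n − 1)/2, the terms with i ≥ 1 go the wrong way; but at y = 1
-- the inequality follows from the bi-γ-positivity of p(x, 1), whose two halves are symmetric
-- unimodal about (n − 1)/2 and n/2, and lowering y from 1 only shrinks the wrong-way terms.
module Submission where

open import Defs
open import Level using (Level)
open import Data.Nat using (ℕ; zero; suc; _<_; _≥_; _∸_; ⌊_/2⌋; z≤n; s≤s)
open import Relation.Nullary using (¬_; yes; no)
import Data.Nat as ℕ
import Data.Nat.Properties as ℕ
open import Data.List using ([]; _∷_)
open import Relation.Binary.PropositionalEquality using (_≡_; _≢_)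
import Relation.Binary.PropositionalEquality as Eq
open import Algebra.Bundles using (CommutativeRing)
open import Data.Sum using (_⊎_; inj₁; inj₂)
open import Data.Product using (_×_; _,_; proj₁; proj₂; ∃₂)
open import Relation.Binary.Bundles using (Preorder)
open import Relation.Binary.Structures using (IsTotalOrder)

m≤⌊n/2⌋⇒2*m≤n : ∀ n m → m ℕ.≤ ⌊ n /2⌋ → 2 ℕ.* m ℕ.≤ n
m≤⌊n/2⌋⇒2*m≤n zero          zero    z≤n     = z≤n
m≤⌊n/2⌋⇒2*m≤n (suc zero)    zero    z≤n     = z≤n
m≤⌊n/2⌋⇒2*m≤n (suc (suc n)) zero    z≤n     = z≤n
m≤⌊n/2⌋⇒2*m≤n (suc (suc n)) (suc m) (s≤s p) =
  Eq.subst (ℕ._≤ suc (suc n)) (Eq.sym (ℕ.*-suc 2 m))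
    (s≤s (s≤s (m≤⌊n/2⌋⇒2*m≤n n m p)))

2*m≤n⇒m≤n∸m : ∀ {m n} → 2 ℕ.* m ℕ.≤ n → m ℕ.≤ n ∸ m
2*m≤n⇒m≤n∸m {m} {n} 2m≤n =
  ℕ.m+n≤o⇒m≤o∸n m (Eq.subst (ℕ._≤ n) (Eq.cong (m ℕ.+_) (ℕ.+-identityʳ m)) 2m≤n)

m<⌊n/2⌋⇒2*m≤n∸2 : ∀ n m → m < ⌊ n /2⌋ → 2 ℕ.* m ℕ.≤ n ∸ 2
m<⌊n/2⌋⇒2*m≤n∸2 (suc (suc n)) m (s≤s m≤⌊n/2⌋) = m≤⌊n/2⌋⇒2*m≤n n m m≤⌊n/2⌋

-- b lies between a and its mirror image s − a.
Inward : ℕ → ℕ → ℕ → Set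
Inward s a b = (a ℕ.≤ b × a ℕ.+ b ℕ.≤ s) ⊎ (b ℕ.≤ a × s ℕ.≤ a ℕ.+ b)

inward-pred : ∀ {s a b} → Inward (2 ℕ.+ s) (suc a) (suc b) → Inward s a b
inward-pred {s} {a} {b} (inj₁ (s≤s a≤b , s≤s a+1+b≤1+s)) =
  inj₁ (a≤b , ℕ.≤-pred (Eq.subst (ℕ._≤ suc s) (ℕ.+-suc a b) a+1+b≤1+s))
inward-pred {s} {a} {b} (inj₂ (s≤s b≤a , s≤s 1+s≤a+1+b)) =
  inj₂ (b≤a , ℕ.≤-pred (Eq.subst (suc s ℕ.≤_) (ℕ.+-suc a b) 1+s≤a+1+b))

inward-split : ∀ {s a b} → a ≢ b → Inward (suc s) (suc a) (suc b) →
               Inward s (suc a) b × Inward s a (suc b)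
inward-split {s} {a} {b} a≢b (inj₁ (s≤s a≤b , s≤s a+1+b≤s)) =
  inj₁ (ℕ.≤∧≢⇒< a≤b a≢b , Eq.subst (ℕ._≤ s) (ℕ.+-suc a b) a+1+b≤s) ,
  inj₁ (ℕ.m≤n⇒m≤1+n a≤b , a+1+b≤s)
inward-split {s} {a} {b} a≢b (inj₂ (s≤s b≤a , s≤s s≤a+1+b)) =
  inj₂ (ℕ.m≤n⇒m≤1+n b≤a , Eq.subst (s ℕ.≤_) (ℕ.+-suc a b) s≤a+1+b) ,
  inj₂ (ℕ.≤∧≢⇒< b≤a (λ b≡a → a≢b (Eq.sym b≡a)) , s≤a+1+b)

inward-to-mirror : ∀ {s d k} → k ℕ.≤ d ∸ k → d ℕ.≤ s → Inward s k (d ∸ k)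
inward-to-mirror {s} {d} {k} k≤d∸k d≤s = inj₁ (k≤d∸k , ℕ.≤-trans (ℕ.≤-reflexive k+[d∸k]≡d) d≤s)
  where
  k+[d∸k]≡d : k ℕ.+ (d ∸ k) ≡ d
  k+[d∸k]≡d = ℕ.m+[n∸m]≡n (ℕ.≤-trans k≤d∸k (ℕ.m∸n≤m d k))

inward-from-mirror : ∀ {s d k} → k ℕ.≤ d ∸ k → s ℕ.≤ d → Inward s (d ∸ k) k
inward-from-mirror {s} {d} {k} k≤d∸k s≤d =
  inj₂ (k≤d∸k , ℕ.≤-trans s≤d (ℕ.≤-reflexive (Eq.sym [d∸k]+k≡d)))
  where
  [d∸k]+k≡d : (d ∸ k) ℕ.+ k ≡ d
  [d∸k]+k≡d = ℕ.m∸n+n≡m (ℕ.≤-trans k≤d∸k (ℕ.m∸n≤m d k))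

module Coefficients {c ℓ} (R : CommutativeRing c ℓ) where
  open CommutativeRing R
  open Poly R

  shift : (ℕ → Carrier) → ℕ → Carrier
  shift f zero    = 0#
  shift f (suc m) = f m

  ∑< : ℕ → (ℕ → Carrier) → Carrier
  ∑< zero    f = 0#
  ∑< (suc k) f = ∑< k f + f k

  coeff-0∷ : ∀ p m → coeff (0# ∷ p) m ≡ shift (coeff p) m
  coeff-0∷ p zero    = Eq.refl
  coeff-0∷ p (suc m) = Eq.refl

  coeff-⊕ : ∀ p q m → coeff (p ⊕ q) m ≈ coeff p m + coeff q m
  coeff-⊕ []      q       m       = sym (+-identityˡ _)
  coeff-⊕ (a ∷ p) []      m       = sym (+-identityʳ _)
  coeff-⊕ (a ∷ p) (b ∷ q) zero    = refl
  coeff-⊕ (a ∷ p) (b ∷ q) (suc m) = coeff-⊕ p q m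

  coeff-scale : ∀ a p m → coeff (scale a p) m ≈ a * coeff p m
  coeff-scale a []      m       = sym (zeroʳ a)
  coeff-scale a (b ∷ p) zero    = refl
  coeff-scale a (b ∷ p) (suc m) = coeff-scale a p m

  coeff-∷⊗ : ∀ a p q m → coeff ((a ∷ p) ⊗ q) m ≈ a * coeff q m + shift (coeff (p ⊗ q)) m
  coeff-∷⊗ a p q m = trans (coeff-⊕ (scale a q) (0# ∷ (p ⊗ q)) m)
    (+-cong (coeff-scale a q m) (reflexive (coeff-0∷ (p ⊗ q) m)))

  shift-cong : ∀ {f g} → (∀ m → f m ≈ g m) → ∀ m → shift f m ≈ shift g m
  shift-cong f≈g zero    = refl
  shift-cong f≈g (suc m) = f≈g m

  coeff-⊗-zeroˡ : ∀ p q → (∀ m → coeff p m ≈ 0#) → ∀ m → coeff (p ⊗ q) m ≈ 0#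
  coeff-⊗-zeroˡ []      q p≈0 m = refl
  coeff-⊗-zeroˡ (a ∷ p) q p≈0 m = trans (coeff-∷⊗ a p q m)
    (trans (+-cong (trans (*-congʳ (p≈0 0)) (zeroˡ _)) (tail m)) (+-identityʳ 0#))
    where
    tail : ∀ m → shift (coeff (p ⊗ q)) m ≈ 0#
    tail zero    = refl
    tail (suc m) = coeff-⊗-zeroˡ p q (λ k → p≈0 (suc k)) m

  coeff-⊗-congˡ : ∀ p p′ q → (∀ m → coeff p m ≈ coeff p′ m) →
                  ∀ m → coeff (p ⊗ q) m ≈ coeff (p′ ⊗ q) m
  coeff-⊗-congˡ []      []        q p≈p′ m = refl
  coeff-⊗-congˡ []      (a ∷ p′)  q p≈p′ m = sym (coeff-⊗-zeroˡ (a ∷ p′) q (λ k → sym (p≈p′ k)) m)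
  coeff-⊗-congˡ (a ∷ p) []        q p≈p′ m = coeff-⊗-zeroˡ (a ∷ p) q p≈p′ m
  coeff-⊗-congˡ (a ∷ p) (a′ ∷ p′) q p≈p′ m = begin
    coeff ((a ∷ p) ⊗ q) m                     ≈⟨ coeff-∷⊗ a p q m ⟩
    a * coeff q m + shift (coeff (p ⊗ q)) m   ≈⟨ +-cong (*-congʳ (p≈p′ 0)) (shift-cong tail m) ⟩
    a′ * coeff q m + shift (coeff (p′ ⊗ q)) m ≈⟨ coeff-∷⊗ a′ p′ q m ⟨
    coeff ((a′ ∷ p′) ⊗ q) m                   ∎
    where
    open import Relation.Binary.Reasoning.Setoid setoid
    tail : ∀ m → coeff (p ⊗ q) m ≈ coeff (p′ ⊗ q) m
    tail = coeff-⊗-congˡ p p′ q (λ k → p≈p′ (suc k))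

  coeff-one⊗ : ∀ q m → coeff (one ⊗ q) m ≈ coeff q m
  coeff-one⊗ q m = trans (coeff-∷⊗ 1# [] q m) (trans (+-cong (*-identityˡ _) (tail m)) (+-identityʳ _))
    where
    tail : ∀ m → shift (coeff ([] ⊗ q)) m ≈ 0#
    tail zero    = refl
    tail (suc m) = refl

  coeff-X⊗ : ∀ q m → coeff (X ⊗ q) m ≈ shift (coeff q) m
  coeff-X⊗ q m = trans (coeff-∷⊗ 0# one q m)
    (trans (+-cong (zeroˡ _) (shift-cong (coeff-one⊗ q) m)) (+-identityˡ _))

  coeff-1+X⊗ : ∀ q m → coeff (1+X ⊗ q) m ≈ coeff q m + shift (coeff q) m
  coeff-1+X⊗ q m = trans (coeff-∷⊗ 1# one q m)
    (+-cong (*-identityˡ _) (shift-cong (coeff-one⊗ q) m))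

  coeff-X^suc⊗ : ∀ j q m → coeff ((X ^ₚ suc j) ⊗ q) m ≈ shift (coeff ((X ^ₚ j) ⊗ q)) m
  coeff-X^suc⊗ j q m = trans (coeff-⊗-congˡ (X ⊗ (X ^ₚ j)) (0# ∷ (X ^ₚ j)) q X⊗X^j m)
    (trans (coeff-∷⊗ 0# (X ^ₚ j) q m) (trans (+-congʳ (zeroˡ _)) (+-identityˡ _)))
    where
    X⊗X^j : ∀ m → coeff (X ⊗ (X ^ₚ j)) m ≈ coeff (0# ∷ (X ^ₚ j)) m
    X⊗X^j m = trans (coeff-X⊗ (X ^ₚ j) m) (reflexive (Eq.sym (coeff-0∷ (X ^ₚ j) m)))

  coeff-Σ< : ∀ k f m → coeff (Σ< k f) m ≈ ∑< k (λ i → coeff (f i) m)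
  coeff-Σ< zero    f m = refl
  coeff-Σ< (suc k) f m = trans (coeff-⊕ (Σ< k f) (f k) m) (+-congʳ (coeff-Σ< k f m))

  ∑<-cong : ∀ k {f g} → (∀ i → i < k → f i ≈ g i) → ∑< k f ≈ ∑< k g
  ∑<-cong zero    f≈g = refl
  ∑<-cong (suc k) f≈g = +-cong (∑<-cong k (λ i i<k → f≈g i (ℕ.m<n⇒m<1+n i<k))) (f≈g k ℕ.≤-refl)

  ∑<-+ : ∀ k f g → ∑< k (λ i → f i + g i) ≈ ∑< k f + ∑< k g
  ∑<-+ zero    f g = sym (+-identityʳ 0#)
  ∑<-+ (suc k) f g = trans (+-congʳ (∑<-+ k f g)) (interchange (∑< k f) (∑< k g) (f k) (g k))
    where open import Algebra.Properties.CommutativeSemigroup +-commutativeSemigroup using (interchange)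

module OrderedFieldProperties {c ℓ₁ ℓ₂} (F : OrderedField c ℓ₁ ℓ₂) where
  open OrderedField F
  open Poly commutativeRing
  open Coefficients commutativeRing
  open import Algebra.Properties.Ring ring
    using (//-rightDividesˡ; //-rightDividesʳ; -1*x≈-x; -‿involutive)
  open import Algebra.Properties.CommutativeSemigroup +-commutativeSemigroup using (x∙yz≈y∙xz)
  open IsTotalOrder isTotalOrder public
    using (total)
    renaming ( refl to ≤-refl; trans to ≤-trans; reflexive to ≤-reflexive
             ; ≲-respˡ-≈ to ≤-respˡ-≈; ≲-respʳ-≈ to ≤-respʳ-≈ )

  ≤-preorder : Preorder c ℓ₁ ℓ₂
  ≤-preorder = record { isPreorder = IsTotalOrder.isPreorder isTotalOrder }

  open import Relation.Binary.Reasoning.Preorder ≤-preorder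

  +-monoʳ-≤ : ∀ x {a b} → a ≤ b → (x + a) ≤ (x + b)
  +-monoʳ-≤ x {a} {b} a≤b = begin
    x + a ≈⟨ +-comm x a ⟩
    a + x ≲⟨ +-mono-≤ x a≤b ⟩
    b + x ≈⟨ +-comm b x ⟩
    x + b ∎

  +-mono₂-≤ : ∀ {a b x y} → a ≤ b → x ≤ y → (a + x) ≤ (b + y)
  +-mono₂-≤ {a} {b} {x} a≤b x≤y = ≤-trans (+-mono-≤ x a≤b) (+-monoʳ-≤ b x≤y)

  +-cancelʳ-≤ : ∀ x {a b} → (a + x) ≤ (b + x) → a ≤ b
  +-cancelʳ-≤ x {a} {b} a+x≤b+x = begin
    a           ≈⟨ //-rightDividesʳ x a ⟨
    a + x - x   ≲⟨ +-mono-≤ (- x) a+x≤b+x ⟩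
    b + x - x   ≈⟨ //-rightDividesʳ x b ⟩
    b           ∎

  x≤y⇒0≤y-x : ∀ {x y} → x ≤ y → 0# ≤ (y - x)
  x≤y⇒0≤y-x {x} {y} x≤y = begin
    0#     ≈⟨ -‿inverseʳ x ⟨
    x - x  ≲⟨ +-mono-≤ (- x) x≤y ⟩
    y - x  ∎

  *-monoʳ-≤-nonneg : ∀ {x a b} → 0# ≤ x → a ≤ b → (x * a) ≤ (x * b)
  *-monoʳ-≤-nonneg {x} {a} {b} 0≤x a≤b = begin
    x * a                 ≈⟨ +-identityʳ (x * a) ⟨
    x * a + 0#            ≲⟨ +-monoʳ-≤ (x * a) (*-nonneg 0≤x (x≤y⇒0≤y-x a≤b)) ⟩
    x * a + x * (b - a)   ≈⟨ distribˡ x a (b - a) ⟨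
    x * (a + (b - a))     ≈⟨ *-congˡ (trans (+-comm a (b - a)) (//-rightDividesˡ a b)) ⟩
    x * b                 ∎

  0≤1 : 0# ≤ 1#
  0≤1 with total 0# 1#
  ... | inj₁ 0≤1 = 0≤1
  ... | inj₂ 1≤0 = begin
    0#            ≲⟨ *-nonneg 0≤-1 0≤-1 ⟩
    - 1# * - 1#   ≈⟨ -1*x≈-x (- 1#) ⟩
    - - 1#        ≈⟨ -‿involutive 1# ⟩
    1#            ∎
    where
    0≤-1 : 0# ≤ (- 1#)
    0≤-1 = ≤-respʳ-≈ (+-identityˡ (- 1#)) (x≤y⇒0≤y-x 1≤0)

  ^-nonneg : ∀ {y} → 0# ≤ y → ∀ i → 0# ≤ (y ^ i)
  ^-nonneg 0≤y zero    = 0≤1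
  ^-nonneg 0≤y (suc i) = *-nonneg 0≤y (^-nonneg 0≤y i)

  ^-≤1 : ∀ {y} → 0# ≤ y → y ≤ 1# → ∀ i → (y ^ i) ≤ 1#
  ^-≤1 0≤y y≤1 zero        = ≤-refl
  ^-≤1 {y} 0≤y y≤1 (suc i) = begin
    y * y ^ i  ≲⟨ *-monoʳ-≤-nonneg 0≤y (^-≤1 0≤y y≤1 i) ⟩
    y * 1#     ≈⟨ *-identityʳ y ⟩
    y          ≲⟨ y≤1 ⟩
    1#         ∎

  -- Write a and b as t-weighted plus (1 - t)-weighted parts; only the (1 - t)-parts differ.
  t*a+b≤t*b+a : ∀ {t a b} → 0# ≤ t → t ≤ 1# → b ≤ a → (t * a + b) ≤ (t * b + a)
  t*a+b≤t*b+a {t} {a} {b} 0≤t t≤1 b≤a = begin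
    t * a + b                ≈⟨ +-congˡ (split b) ⟨
    t * a + (t * b + u * b)  ≈⟨ x∙yz≈y∙xz (t * a) (t * b) (u * b) ⟩
    t * b + (t * a + u * b)  ≲⟨ +-monoʳ-≤ (t * b) (+-monoʳ-≤ (t * a) (*-monoʳ-≤-nonneg 0≤u b≤a)) ⟩
    t * b + (t * a + u * a)  ≈⟨ +-congˡ (split a) ⟩
    t * b + a                ∎
    where
    u = 1# - t
    0≤u : 0# ≤ u
    0≤u = x≤y⇒0≤y-x t≤1
    split : ∀ x → t * x + u * x ≈ x
    split x = trans (sym (distribʳ x t u))
      (trans (*-congʳ (trans (+-comm t u) (//-rightDividesˡ t 1#))) (*-identityˡ x))

  ∑<-mono : ∀ k {f g} → (∀ i → i < k → f i ≤ g i) → ∑< k f ≤ ∑< k g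
  ∑<-mono zero    f≤g = ≤-refl
  ∑<-mono (suc k) f≤g = +-mono₂-≤ (∑<-mono k (λ i i<k → f≤g i (ℕ.m<n⇒m<1+n i<k))) (f≤g k ℕ.≤-refl)

module SymmetricUnimodal {c ℓ₁ ℓ₂} (F : OrderedField c ℓ₁ ℓ₂) where
  open OrderedField F
  open Poly commutativeRing
  open Coefficients commutativeRing
  open OrderedFieldProperties F

  -- Satisfied by the coefficients of every γ-positive polynomial of degree s: nonnegative,
  -- vanishing beyond s, and symmetric unimodal about s/2 (both encoded by inward-mono).
  record SymUnimodal (s : ℕ) (f : ℕ → Carrier) : Set ℓ₂ where
    field
      inward-mono : ∀ a b → Inward s a b → f a ≤ f b
      nonneg      : ∀ a → 0# ≤ f a
      ≤0-beyond   : ∀ a → s < a → f a ≤ 0#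

  open SymUnimodal

  symUnimodal-resp : ∀ {s f g} → (∀ a → f a ≈ g a) → SymUnimodal s f → SymUnimodal s g
  symUnimodal-resp f≈g U = record
    { inward-mono = λ a b in′ → ≤-respʳ-≈ (f≈g b) (≤-respˡ-≈ (f≈g a) (inward-mono U a b in′))
    ; nonneg      = λ a → ≤-respʳ-≈ (f≈g a) (nonneg U a)
    ; ≤0-beyond   = λ a s<a → ≤-respˡ-≈ (f≈g a) (≤0-beyond U a s<a)
    }

  symUnimodal-0 : ∀ {s} → SymUnimodal s (λ _ → 0#)
  symUnimodal-0 = record
    { inward-mono = λ _ _ _ → ≤-refl ; nonneg = λ _ → ≤-refl ; ≤0-beyond = λ _ _ → ≤-refl }

  symUnimodal-+ : ∀ {s f g} → SymUnimodal s f → SymUnimodal s g → SymUnimodal s (λ a → f a + g a)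
  symUnimodal-+ U V = record
    { inward-mono = λ a b in′ → +-mono₂-≤ (inward-mono U a b in′) (inward-mono V a b in′)
    ; nonneg      = λ a → ≤-respˡ-≈ (+-identityʳ 0#) (+-mono₂-≤ (nonneg U a) (nonneg V a))
    ; ≤0-beyond   = λ a s<a →
        ≤-respʳ-≈ (+-identityʳ 0#) (+-mono₂-≤ (≤0-beyond U a s<a) (≤0-beyond V a s<a))
    }

  symUnimodal-* : ∀ {s f x} → 0# ≤ x → SymUnimodal s f → SymUnimodal s (λ a → x * f a)
  symUnimodal-* {x = x} 0≤x U = record
    { inward-mono = λ a b in′ → *-monoʳ-≤-nonneg 0≤x (inward-mono U a b in′)
    ; nonneg      = λ a → *-nonneg 0≤x (nonneg U a)
    ; ≤0-beyond   = λ a s<a → ≤-respʳ-≈ (zeroʳ x) (*-monoʳ-≤-nonneg 0≤x (≤0-beyond U a s<a))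
    }

  symUnimodal-Σ< : ∀ {s} k fs → (∀ i → i < k → SymUnimodal s (coeff (fs i))) →
                   SymUnimodal s (coeff (Σ< k fs))
  symUnimodal-Σ< zero    fs U = symUnimodal-0
  symUnimodal-Σ< (suc k) fs U = symUnimodal-resp (λ a → sym (coeff-⊕ (Σ< k fs) (fs k) a))
    (symUnimodal-+ (symUnimodal-Σ< k fs (λ i i<k → U i (ℕ.m<n⇒m<1+n i<k))) (U k ℕ.≤-refl))

  symUnimodal-one : SymUnimodal 0 (coeff one)
  symUnimodal-one = record { inward-mono = mono ; nonneg = nonneg′ ; ≤0-beyond = beyond }
    where
    nonneg′ : ∀ a → 0# ≤ coeff one a
    nonneg′ zero    = 0≤1
    nonneg′ (suc a) = ≤-refl
    mono : ∀ a b → Inward 0 a b → coeff one a ≤ coeff one b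
    mono zero    zero    _                = ≤-refl
    mono zero    (suc b) (inj₁ (_ , ()))
    mono zero    (suc b) (inj₂ (() , _))
    mono (suc a) b       _                = nonneg′ b
    beyond : ∀ a → 0 < a → coeff one a ≤ 0#
    beyond (suc a) _ = ≤-refl

  symUnimodal-shift : ∀ {s f} → SymUnimodal s f → SymUnimodal (2 ℕ.+ s) (shift f)
  symUnimodal-shift {s} {f} U = record { inward-mono = mono ; nonneg = nonneg′ ; ≤0-beyond = beyond }
    where
    nonneg′ : ∀ a → 0# ≤ shift f a
    nonneg′ zero    = ≤-refl
    nonneg′ (suc a) = nonneg U a
    mono : ∀ a b → Inward (2 ℕ.+ s) a b → shift f a ≤ shift f b
    mono zero    b       _                  = nonneg′ b
    mono (suc a) zero    (inj₁ (() , _))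
    mono (suc a) zero    (inj₂ (_ , s+2≤a+1)) =
      ≤0-beyond U a (ℕ.≤-pred (Eq.subst (2 ℕ.+ s ℕ.≤_) (ℕ.+-identityʳ (suc a)) s+2≤a+1))
    mono (suc a) (suc b) in′                = inward-mono U a b (inward-pred in′)
    beyond : ∀ a → 2 ℕ.+ s < a → shift f a ≤ 0#
    beyond (suc a) (s≤s s+2≤a) = ≤0-beyond U a (ℕ.<⇒≤ s+2≤a)

  symUnimodal-step : ∀ {s f} → SymUnimodal s f → SymUnimodal (suc s) (λ a → f a + shift f a)
  symUnimodal-step {s} {f} U = record { inward-mono = mono ; nonneg = nonneg′ ; ≤0-beyond = beyond }
    where
    g : ℕ → Carrier
    g a = f a + shift f a
    nonneg′ : ∀ a → 0# ≤ g a
    nonneg′ a = ≤-respˡ-≈ (+-identityʳ 0#)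
      (+-mono₂-≤ (nonneg U a) (nonneg (symUnimodal-shift U) a))
    mono : ∀ a b → Inward (suc s) a b → g a ≤ g b
    mono zero    zero    _                      = ≤-refl
    mono zero    (suc b) (inj₁ (_ , s≤s b≤s))    =
      ≤-respʳ-≈ (+-comm (f b) (f (suc b)))
        (+-mono₂-≤ (inward-mono U 0 b (inj₁ (z≤n , b≤s))) (nonneg U (suc b)))
    mono zero    (suc b) (inj₂ (() , _))
    mono (suc a) zero    (inj₁ (() , _))
    mono (suc a) zero    (inj₂ (_ , s≤s s≤a+0)) =
      ≤-respʳ-≈ (+-comm 0# (f 0))
        (+-mono₂-≤ (≤0-beyond U (suc a) (s≤s s≤a)) (inward-mono U a 0 (inj₂ (z≤n , s≤a+0))))
      where
      s≤a : s ℕ.≤ a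
      s≤a = Eq.subst (s ℕ.≤_) (ℕ.+-identityʳ a) s≤a+0
    mono (suc a) (suc b) in′ with a ℕ.≟ b
    ... | yes Eq.refl = ≤-refl
    ... | no a≢b      =
      ≤-respʳ-≈ (+-comm (f b) (f (suc b)))
        (+-mono₂-≤ (inward-mono U (suc a) b (proj₁ split)) (inward-mono U a (suc b) (proj₂ split)))
      where split = inward-split a≢b in′
    beyond : ∀ a → suc s < a → g a ≤ 0#
    beyond (suc a) (s≤s s<a) =
      ≤-respʳ-≈ (+-identityʳ 0#) (+-mono₂-≤ (≤0-beyond U (suc a) (ℕ.m<n⇒m<1+n s<a)) (≤0-beyond U a s<a))

  symUnimodal-binomial : ∀ m → SymUnimodal m (coeff (1+X ^ₚ m))
  symUnimodal-binomial zero    = symUnimodal-one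
  symUnimodal-binomial (suc m) =
    symUnimodal-resp (λ a → sym (coeff-1+X⊗ (1+X ^ₚ m) a)) (symUnimodal-step (symUnimodal-binomial m))

  symUnimodal-monomial⊗binomial : ∀ j m → SymUnimodal (2 ℕ.* j ℕ.+ m) (coeff ((X ^ₚ j) ⊗ (1+X ^ₚ m)))
  symUnimodal-monomial⊗binomial zero    m =
    symUnimodal-resp (λ a → sym (coeff-one⊗ (1+X ^ₚ m) a)) (symUnimodal-binomial m)
  symUnimodal-monomial⊗binomial (suc j) m =
    Eq.subst (λ s → SymUnimodal s (coeff ((X ^ₚ suc j) ⊗ (1+X ^ₚ m))))
      (Eq.cong (ℕ._+ m) (Eq.sym (ℕ.*-suc 2 j)))
      (symUnimodal-resp (λ a → sym (coeff-X^suc⊗ j (1+X ^ₚ m) a))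
        (symUnimodal-shift (symUnimodal-monomial⊗binomial j m)))

  γ-term : ℕ → ℕ → Pol
  γ-term s j = (X ^ₚ j) ⊗ (1+X ^ₚ (s ∸ 2 ℕ.* j))

  symUnimodal-γ-term : ∀ s j → 2 ℕ.* j ℕ.≤ s → SymUnimodal s (coeff (γ-term s j))
  symUnimodal-γ-term s j 2j≤s = Eq.subst (λ s′ → SymUnimodal s′ (coeff (γ-term s j)))
    (ℕ.m+[n∸m]≡n 2j≤s) (symUnimodal-monomial⊗binomial j (s ∸ 2 ℕ.* j))

  γ-sum : ℕ → ℕ → (ℕ → Carrier) → Pol
  γ-sum s k ξ = Σ< k λ j → scale (ξ j) (γ-term s j)

  symUnimodal-γ-sum : ∀ s k ξ → (∀ j → j < k → 2 ℕ.* j ℕ.≤ s) → (∀ j → j < k → 0# ≤ ξ j) →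
                      SymUnimodal s (coeff (γ-sum s k ξ))
  symUnimodal-γ-sum s k ξ 2j≤s 0≤ξ = symUnimodal-Σ< k (λ j → scale (ξ j) (γ-term s j)) λ j j<k →
    symUnimodal-resp (λ a → sym (coeff-scale (ξ j) (γ-term s j) a))
      (symUnimodal-* (0≤ξ j j<k) (symUnimodal-γ-term s j (2j≤s j j<k)))

  biγ-to-mirror : ∀ d ξ η → (∀ k → k < suc ⌊ d /2⌋ → 0# ≤ ξ k) → (∀ k → k < ⌊ suc d /2⌋ → 0# ≤ η k) →
                  ∀ k → 2 ℕ.* k ℕ.≤ d → coeff (biγ (suc d) ξ η) k ≤ coeff (biγ (suc d) ξ η) (d ∸ k)
  biγ-to-mirror d ξ η 0≤ξ 0≤η k 2k≤d = begin
    coeff (biγ (suc d) ξ η) k       ≈⟨ coeff-biγ k ⟩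
    A k + shift B k                 ≲⟨ +-mono₂-≤ A-mono XB-mono ⟩
    A (d ∸ k) + shift B (d ∸ k)     ≈⟨ coeff-biγ (d ∸ k) ⟨
    coeff (biγ (suc d) ξ η) (d ∸ k) ∎
    where
    open import Relation.Binary.Reasoning.Preorder ≤-preorder
    γξ γη : Pol
    γξ = γ-sum d (suc ⌊ d /2⌋) ξ
    γη = γ-sum (d ∸ 1) ⌊ suc d /2⌋ η
    A B : ℕ → Carrier
    A = coeff γξ
    B = coeff γη
    coeff-biγ : ∀ a → coeff (biγ (suc d) ξ η) a ≈ A a + shift B a
    coeff-biγ a = trans (coeff-⊕ γξ (X ⊗ γη) a) (+-congˡ (coeff-X⊗ γη a))
    symUnimodal-A : SymUnimodal d A
    symUnimodal-A = symUnimodal-γ-sum d (suc ⌊ d /2⌋) ξ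
      (λ j j<1+⌊d/2⌋ → m≤⌊n/2⌋⇒2*m≤n d j (ℕ.≤-pred j<1+⌊d/2⌋)) 0≤ξ
    symUnimodal-XB : SymUnimodal (2 ℕ.+ (d ∸ 1)) (shift B)
    symUnimodal-XB = symUnimodal-shift
      (symUnimodal-γ-sum (d ∸ 1) ⌊ suc d /2⌋ η (m<⌊n/2⌋⇒2*m≤n∸2 (suc d)) 0≤η)
    k≤d∸k : k ℕ.≤ d ∸ k
    k≤d∸k = 2*m≤n⇒m≤n∸m 2k≤d
    d≤2+[d∸1] : d ℕ.≤ 2 ℕ.+ (d ∸ 1)
    d≤2+[d∸1] = ℕ.m≤n⇒m≤1+n (ℕ.m≤n+m∸n d 1)
    A-mono : A k ≤ A (d ∸ k)
    A-mono = inward-mono symUnimodal-A k (d ∸ k) (inward-to-mirror k≤d∸k ℕ.≤-refl)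
    XB-mono : shift B k ≤ shift B (d ∸ k)
    XB-mono = inward-mono symUnimodal-XB k (d ∸ k) (inward-to-mirror k≤d∸k d≤2+[d∸1])

module BivariateProperties {c ℓ₁ ℓ₂} (F : OrderedField c ℓ₁ ℓ₂) (n : ℕ)
  (μ : ℕ → ℕ → OrderedField.Carrier F)
  (0≤μ : ∀ i j → i < suc n → j < suc ⌊ n ∸ i /2⌋ → OrderedField._≤_ F (OrderedField.0# F) (μ i j))
  where
  open OrderedField F
  open Poly commutativeRing
  open Coefficients commutativeRing
  open OrderedFieldProperties F
  open SymmetricUnimodal F
  open SymUnimodal
  open import Relation.Binary.Reasoning.Preorder ≤-preorder

  pᵢ : ℕ → Pol
  pᵢ i = γ-sum (n ∸ i) (suc ⌊ n ∸ i /2⌋) (μ i)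

  symUnimodal-pᵢ : ∀ i → i < suc n → SymUnimodal (n ∸ i) (coeff (pᵢ i))
  symUnimodal-pᵢ i i<1+n = symUnimodal-γ-sum (n ∸ i) (suc ⌊ n ∸ i /2⌋) (μ i)
    (λ j j<1+⌊n∸i/2⌋ → m≤⌊n/2⌋⇒2*m≤n (n ∸ i) j (ℕ.≤-pred j<1+⌊n∸i/2⌋)) (λ j → 0≤μ i j i<1+n)

  P : Carrier → ℕ → Carrier
  P y = coeff (pxy n μ y)

  coeff-pxy : ∀ y a → P y a ≈ ∑< (suc n) (λ i → y ^ i * coeff (pᵢ i) a)
  coeff-pxy y a = trans (coeff-Σ< (suc n) (λ i → scale (y ^ i) (pᵢ i)) a)
    (∑<-cong (suc n) λ i _ → coeff-scale (y ^ i) (pᵢ i) a)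

  coeff-pxy-1 : ∀ a → P 1# a ≈ ∑< (suc n) (λ i → coeff (pᵢ i) a)
  coeff-pxy-1 a = trans (coeff-pxy 1# a)
    (∑<-cong (suc n) λ i _ → trans (*-congʳ (1^i≈1 i)) (*-identityˡ _))
    where
    1^i≈1 : ∀ i → 1# ^ i ≈ 1#
    1^i≈1 zero    = refl
    1^i≈1 (suc i) = trans (*-identityˡ _) (1^i≈1 i)

  pxy-mono : ∀ {y} → 0# ≤ y → ∀ a b → (∀ i → i < suc n → Inward (n ∸ i) a b) → P y a ≤ P y b
  pxy-mono {y} 0≤y a b inward = begin
    P y a                                          ≈⟨ coeff-pxy y a ⟩
    ∑< (suc n) (λ i → y ^ i * coeff (pᵢ i) a)      ≲⟨ ∑<-mono (suc n) termwise ⟩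
    ∑< (suc n) (λ i → y ^ i * coeff (pᵢ i) b)      ≈⟨ coeff-pxy y b ⟨
    P y b                                          ∎
    where
    termwise : ∀ i → i < suc n → (y ^ i * coeff (pᵢ i) a) ≤ (y ^ i * coeff (pᵢ i) b)
    termwise i i<1+n = *-monoʳ-≤-nonneg (^-nonneg 0≤y i)
      (inward-mono (symUnimodal-pᵢ i i<1+n) a b (inward i i<1+n))

  -- P y b − P y a = (P 1 b − P 1 a) + Σ_{i ≥ 1} (1 − yⁱ) (pᵢ a − pᵢ b).
  pxy-mono-from-1 : ∀ {y} → 0# ≤ y → y ≤ 1# → ∀ a b →
                    (∀ i → i < n → Inward (n ∸ suc i) b a) → P 1# a ≤ P 1# b → P y a ≤ P y b
  pxy-mono-from-1 {y} 0≤y y≤1 a b inward P1a≤P1b = +-cancelʳ-≤ (P 1# b) (begin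
    P y a + P 1# b
      ≈⟨ +-cong (coeff-pxy y a) (coeff-pxy-1 b) ⟩
    ∑< (suc n) (λ i → y ^ i * coeff (pᵢ i) a) + ∑< (suc n) (λ i → coeff (pᵢ i) b)
      ≈⟨ ∑<-+ (suc n) _ _ ⟨
    ∑< (suc n) (λ i → y ^ i * coeff (pᵢ i) a + coeff (pᵢ i) b)
      ≲⟨ ∑<-mono (suc n) termwise ⟩
    ∑< (suc n) (λ i → y ^ i * coeff (pᵢ i) b + coeff (pᵢ i) a)
      ≈⟨ ∑<-+ (suc n) _ _ ⟩
    ∑< (suc n) (λ i → y ^ i * coeff (pᵢ i) b) + ∑< (suc n) (λ i → coeff (pᵢ i) a)
      ≈⟨ +-cong (coeff-pxy y b) (coeff-pxy-1 a) ⟨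
    P y b + P 1# a
      ≲⟨ +-monoʳ-≤ (P y b) P1a≤P1b ⟩
    P y b + P 1# b ∎)
    where
    termwise : ∀ i → i < suc n →
               (y ^ i * coeff (pᵢ i) a + coeff (pᵢ i) b) ≤ (y ^ i * coeff (pᵢ i) b + coeff (pᵢ i) a)
    termwise zero    _            = ≤-reflexive (trans (+-congʳ (*-identityˡ _))
      (trans (+-comm _ _) (+-congʳ (sym (*-identityˡ _)))))
    termwise (suc i) (s≤s i<n) = t*a+b≤t*b+a (^-nonneg 0≤y (suc i)) (^-≤1 0≤y y≤1 (suc i))
      (inward-mono (symUnimodal-pᵢ (suc i) (s≤s i<n)) b a (inward i i<n))

theorem6 : ∀ {c ℓ₁ ℓ₂ : Level} (F : OrderedField c ℓ₁ ℓ₂) →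
    let open OrderedField F
        open Poly commutativeRing
    in (n : ℕ) → 1 Data.Nat.≤ n →
       (μ : ℕ → ℕ → Carrier) →
       (∀ i j → i < suc n → j < suc ⌊ n ∸ i /2⌋ → 0# ≤ μ i j) →
       ¬ (coeff (pxy n μ 1#) (n ∸ 1) ≈ 0#) →
       (∀ m → m ≥ n → coeff (pxy n μ 1#) m ≈ 0#) →
       (∃₂ λ (ξ η : ℕ → Carrier) →
          (∀ k → k < suc ⌊ n ∸ 1 /2⌋ → 0# ≤ ξ k) ×
          (∀ k → k < ⌊ n /2⌋ → 0# ≤ η k) ×
          (∀ m → coeff (pxy n μ 1#) m ≈ coeff (biγ n ξ η) m)) →
       (y : Carrier) → 0# ≤ y → y ≤ 1# →
       AlternatinglyIncreasing F (n ∸ 1) (coeff (pxy n μ y))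
theorem6 F (suc d) _ μ 0≤μ _ _ (ξ , η , 0≤ξ , 0≤η , p₁≈biγ) y 0≤y y≤1 = outer , inner
  where
  open OrderedField F
  open OrderedFieldProperties F using (≤-respˡ-≈; ≤-respʳ-≈)
  open SymmetricUnimodal F using (biγ-to-mirror)
  open BivariateProperties F (suc d) μ 0≤μ

  outer : ∀ k → 2 ℕ.* k < d → P y k ≤ P y (d ∸ k)
  outer k 2k<d = pxy-mono-from-1 0≤y y≤1 k (d ∸ k)
    (λ i _ → inward-from-mirror k≤d∸k (ℕ.m∸n≤m d i))
    (≤-respʳ-≈ (sym (p₁≈biγ (d ∸ k))) (≤-respˡ-≈ (sym (p₁≈biγ k)) (biγ-to-mirror d ξ η 0≤ξ 0≤η k 2k≤d)))
    where
    2k≤d : 2 ℕ.* k ℕ.≤ d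
    2k≤d = ℕ.<⇒≤ 2k<d
    k≤d∸k : k ℕ.≤ d ∸ k
    k≤d∸k = 2*m≤n⇒m≤n∸m 2k≤d

  -- A mirror pair for d + 1 and k + 1, since (d + 1) ∸ (k + 1) = d ∸ k.
  inner : ∀ k → suc (2 ℕ.* k) < d → P y (d ∸ k) ≤ P y (suc k)
  inner k 2k+1<d = pxy-mono 0≤y (d ∸ k) (suc k)
    (λ i _ → inward-from-mirror {d = suc d} (2*m≤n⇒m≤n∸m 2[k+1]≤d+1) (ℕ.m∸n≤m (suc d) i))
    where
    2[k+1]≤d+1 : 2 ℕ.* suc k ℕ.≤ suc d
    2[k+1]≤d+1 = ℕ.≤-trans (ℕ.≤-reflexive (ℕ.*-suc 2 k)) (ℕ.m≤n⇒m≤1+n 2k+1<d)
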